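{- Let $C$ be a co-blocker in $CGG(2m)$. Then $C$ is a perfect matching of $CGG(2m)$, and all the edges of $C$ are of odd order.
   Context: $CGG(2m)$ denotes the complete convex geometric graph on $2m$ vertices: its vertex set is the vertex set of a convex $2m$-gon $P$ in the plane, labelled cyclically $0,1,\dots,2m-1$, and its edges are all closed straight-line segments joining pairs of vertices. The order of an edge $[i,j]$ is $\min(|j-i|,2m-|j-i|)$. A perfect matching is a set of $m$ edges such that every vertex lies in exactly one of them (edges may cross). A simple perfect matching (SPM) is a set of $m$ pairwise disjoint edges (not intersecting even in an interior point). Two sets of edges meet if they have an edge in common. A blocker is a set of edges of minimum cardinality among all sets of edges that meet every SPM. A co-blocker is a set of edges of minimum cardinality among all sets of edges that meet every blocker. -}

module Defs where

open import Data.Nat using (ℕ; zero; suc; _+_; _*_; _∸_; _≤_; _<_; _⊓_)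
open import Data.Fin using (Fin; toℕ)
open import Data.Product using (Σ; _×_; _,_; ∃; ∃-syntax; proj₁; proj₂)
open import Data.Sum using (_⊎_)
open import Data.List using (List; length)
open import Data.List.Relation.Unary.All using (All)
open import Data.List.Relation.Unary.Unique.Propositional using (Unique)
open import Data.List.Membership.Propositional using (_∈_)
open import Relation.Binary.PropositionalEquality using (_≡_; _≢_)
open import Relation.Nullary using (¬_)

-- Vertices of CGG(2m): labelled cyclically 0,1,…,2m-1.
Vertex : ℕ → Set
Vertex m = Fin (2 * m)

-- An edge [i,j] is stored as an ordered pair (i , j) with i < j
-- (each unordered pair of distinct vertices has exactly one such representation).
Edge : ℕ → Set
Edge m = Vertex m × Vertex m

ValidEdge : (m : ℕ) → Edge m → Set
ValidEdge m (i , j) = toℕ i < toℕ j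

IsEdgeSet : (m : ℕ) → List (Edge m) → Set
IsEdgeSet m E = All (ValidEdge m) E × Unique E

order : (m : ℕ) → Edge m → ℕ
order m (i , j) = (toℕ j ∸ toℕ i) ⊓ ((2 * m) ∸ (toℕ j ∸ toℕ i))

Odd : ℕ → Set
Odd n = ∃[ k ] n ≡ suc (2 * k)

Endpoint : (m : ℕ) → Vertex m → Edge m → Set
Endpoint m v (i , j) = (v ≡ i) ⊎ (v ≡ j)

-- Two straight-line segments between vertices of a convex polygon intersect
-- (as closed segments) iff they share an endpoint or their endpoints interleave
-- along the boundary.
Cross : (m : ℕ) → Edge m → Edge m → Set
Cross m (a , b) (c , d) =
  (toℕ a < toℕ c × toℕ c < toℕ b × toℕ b < toℕ d) ⊎
  (toℕ c < toℕ a × toℕ a < toℕ d × toℕ d < toℕ b)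

ShareEndpoint : (m : ℕ) → Edge m → Edge m → Set
ShareEndpoint m e f = ∃[ v ] (Endpoint m v e × Endpoint m v f)

Disjoint : (m : ℕ) → Edge m → Edge m → Set
Disjoint m e f = ¬ ShareEndpoint m e f × ¬ Cross m e f

IsPerfectMatching : (m : ℕ) → List (Edge m) → Set
IsPerfectMatching m M =
  IsEdgeSet m M × length M ≡ m ×
  (∀ (v : Vertex m) →
     (∃[ e ] (e ∈ M × Endpoint m v e)) ×
     (∀ e f → e ∈ M → f ∈ M → Endpoint m v e → Endpoint m v f → e ≡ f))

IsSPM : (m : ℕ) → List (Edge m) → Set
IsSPM m M =
  IsEdgeSet m M × length M ≡ m ×
  (∀ e f → e ∈ M → f ∈ M → e ≢ f → Disjoint m e f)

Meet : (m : ℕ) → List (Edge m) → List (Edge m) → Set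
Meet m A B = ∃[ e ] (e ∈ A × e ∈ B)

MeetsAllSPM : (m : ℕ) → List (Edge m) → Set
MeetsAllSPM m E = ∀ M → IsSPM m M → Meet m E M

IsBlocker : (m : ℕ) → List (Edge m) → Set
IsBlocker m B =
  IsEdgeSet m B × MeetsAllSPM m B ×
  (∀ E → IsEdgeSet m E → MeetsAllSPM m E → length B ≤ length E)

MeetsAllBlockers : (m : ℕ) → List (Edge m) → Set
MeetsAllBlockers m E = ∀ B → IsBlocker m B → Meet m E B

IsCoBlocker : (m : ℕ) → List (Edge m) → Set
IsCoBlocker m C =
  IsEdgeSet m C × MeetsAllBlockers m C ×
  (∀ E → IsEdgeSet m E → MeetsAllBlockers m E → length C ≤ length E)

module Submission where

-- Label the vertices 0, …, 2m-1.  For t < m the edges [i,j] with i + j ≡ 2t+1 (mod 2m)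
-- form a parallel class: m pairwise disjoint chords, i.e. a simple perfect matching (SPM),
-- and every edge of odd order lies in exactly one class.  The classes being edge-disjoint,
-- every edge set meeting all SPMs has at least m edges.  Every edge [a,b] of an SPM has odd
-- gap b - a, since the vertices strictly between a and b are matched among themselves; hence
-- every SPM contains an edge of the star of v (the m edges of odd order at v), and the stars
-- are blockers.  A co-blocker C meets every star, so it covers each vertex by an edge of odd
-- order, while |C| ≤ m because any SPM meets every blocker.  Covering 2m vertices by at most
-- m edges forces every vertex to have degree exactly one, which yields the theorem.
--
-- Counting is done with degrees: deg L u is the number of edges of L at label u, and sums of
-- degrees over ranges of labels are evaluated by double counting (the handshake lemma).

open import Defs
open import Data.Nat using (ℕ; zero; suc; _+_; _*_; _∸_; _≤_; _<_; _≟_; _≤?_; _<?_; z≤n; s≤s)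
open import Data.Nat.Properties
open import Algebra.Properties.CommutativeSemigroup +-commutativeSemigroup using (interchange)
open import Data.Fin using (Fin; toℕ; fromℕ<)
import Data.Fin as Fin
open import Data.Fin.Properties using (toℕ-injective; toℕ<n; toℕ-fromℕ<; injective⇒≤)
open import Relation.Binary using (tri<; tri≈; tri>)
open import Data.Product.Properties using (≡-dec)
open import Data.Product using (Σ-syntax; ∃-syntax; _×_; _,_; proj₁; proj₂)
open import Data.Sum using (_⊎_; inj₁; inj₂)
open import Data.List using (List; []; _∷_; length; filter; tabulate; cartesianProduct; allFin; lookup)
open import Data.List.Properties using (length-tabulate)
open import Data.List.Relation.Unary.Any as Any using ()
open import Data.List.Relation.Unary.Any.Properties using (lookup-index)
open import Data.List.Membership.Propositional.Properties using (∈-filter⁺; ∈-filter⁻; ∈-tabulate⁺; ∈-tabulate⁻; ∈-allFin; ∈-cartesianProduct⁺)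
import Data.List.Relation.Unary.Unique.Propositional.Properties as Unique
open import Data.List.Relation.Unary.All as All using (All; []; _∷_)
open import Data.List.Relation.Unary.Any using (here; there)
open import Data.List.Relation.Unary.AllPairs using ([]; _∷_)
open import Data.List.Membership.Propositional using (_∈_)
open import Data.Empty using (⊥; ⊥-elim)
open import Relation.Nullary using (¬_; Dec; yes; no; contradiction)
open import Relation.Nullary.Decidable using (_×-dec_; _⊎-dec_)
open import Relation.Binary.PropositionalEquality

Even : ℕ → Set
Even n = ∃[ k ] n ≡ 2 * k

even-or-odd : ∀ n → Even n ⊎ Odd n
even-or-odd zero = inj₁ (0 , refl)
even-or-odd (suc n) with even-or-odd n
... | inj₁ (k , refl) = inj₂ (k , refl)
... | inj₂ (k , refl) = inj₁ (suc k , sym (*-distribˡ-+ 2 1 k))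

suc-even : ∀ {n} → Even n → Odd (suc n)
suc-even (k , p) = k , cong suc p

even⇒¬odd : ∀ {n} → Even n → ¬ Odd n
even⇒¬odd (j , refl) (k , eq) = even≢odd j k eq

even+even : ∀ {a b} → Even a → Even b → Even (a + b)
even+even (j , refl) (k , refl) = j + k , sym (*-distribˡ-+ 2 j k)

even+odd : ∀ {a b} → Even a → Odd b → Odd (a + b)
even+odd {a} (j , refl) (k , refl) = j + k , trans (+-suc a (2 * k)) (cong suc (sym (*-distribˡ-+ 2 j k)))

odd-cancelˡ : ∀ {a b} → Even a → Odd (a + b) → Odd b
odd-cancelˡ {a} {b} ea oab with even-or-odd b
... | inj₂ ob = ob
... | inj₁ eb = ⊥-elim (even⇒¬odd (even+even ea eb) oab)

odd-complement : ∀ {N d} → Even N → Odd d → d ≤ N → Odd (N ∸ d)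
odd-complement {N} {d} eN od d≤N with even-or-odd (N ∸ d)
... | inj₂ o = o
... | inj₁ e = ⊥-elim (even⇒¬odd eN (subst Odd (m∸n+n≡m d≤N) (even+odd e od)))

sum≡double+gap : ∀ {a b} → a ≤ b → a + b ≡ 2 * a + (b ∸ a)
sum≡double+gap {a} {b} a≤b = begin
  a + b               ≡⟨ cong (a +_) (sym (m+[n∸m]≡n a≤b)) ⟩
  a + (a + (b ∸ a))   ≡⟨ sym (+-assoc a a (b ∸ a)) ⟩
  (a + a) + (b ∸ a)   ≡⟨ cong (_+ (b ∸ a)) (cong (a +_) (sym (+-identityʳ a))) ⟩
  2 * a + (b ∸ a)     ∎
  where open ≡-Reasoning

odd-gap⇒odd-sum : ∀ {a b} → a ≤ b → Odd (b ∸ a) → Odd (a + b)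
odd-gap⇒odd-sum {a} a≤b o = subst Odd (sym (sum≡double+gap a≤b)) (even+odd (a , refl) o)

odd-sum⇒odd-gap : ∀ {a b} → a ≤ b → Odd (a + b) → Odd (b ∸ a)
odd-sum⇒odd-gap {a} a≤b o = odd-cancelˡ (a , refl) (subst Odd (sum≡double+gap a≤b) o)

𝟙 : ∀ {P : Set} → Dec P → ℕ
𝟙 (yes _) = 1
𝟙 (no _) = 0

𝟙-yes : ∀ {P : Set} (p : Dec P) → P → 𝟙 p ≡ 1
𝟙-yes (yes _) _ = refl
𝟙-yes (no ¬p) p = contradiction p ¬p

𝟙-no : ∀ {P : Set} (p : Dec P) → ¬ P → 𝟙 p ≡ 0
𝟙-no (yes p) ¬p = contradiction p ¬p
𝟙-no (no _) _ = refl

𝟙-cong : ∀ {P Q : Set} → (P → Q) → (Q → P) → (p : Dec P) (q : Dec Q) → 𝟙 p ≡ 𝟙 q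
𝟙-cong P⇒Q _ (yes p) q = sym (𝟙-yes q (P⇒Q p))
𝟙-cong _ Q⇒P (no ¬p) q = sym (𝟙-no q (λ q → ¬p (Q⇒P q)))

𝟙+𝟙-even : ∀ {P Q : Set} → (P → Q) → (Q → P) → (p : Dec P) (q : Dec Q) → Even (𝟙 p + 𝟙 q)
𝟙+𝟙-even P⇒Q Q⇒P p q = 𝟙 p , trans (cong (𝟙 p +_) (sym (𝟙-cong P⇒Q Q⇒P p q))) (cong (𝟙 p +_) (sym (+-identityʳ (𝟙 p))))

sumFrom : (ℕ → ℕ) → ℕ → ℕ → ℕ
sumFrom f s zero = 0
sumFrom f s (suc k) = f s + sumFrom f (suc s) k

InRange : ℕ → ℕ → ℕ → Set
InRange s k u = s ≤ u × u < s + k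

inRange? : ∀ s k u → Dec (InRange s k u)
inRange? s k u = (s ≤? u) ×-dec (u <? s + k)

range-empty : ∀ {s u} → ¬ InRange s 0 u
range-empty {s} {u} (s≤u , u<s+0) = <⇒≱ (subst (u <_) (+-identityʳ s) u<s+0) s≤u

range-head : ∀ {s k} → InRange s (suc k) s
range-head {s} {k} = ≤-refl , subst (s <_) (sym (+-suc s k)) (s≤s (m≤m+n s k))

range-tail : ∀ {s k u} → InRange (suc s) k u → InRange s (suc k) u
range-tail {s} {k} {u} (s<u , u<) = <⇒≤ s<u , subst (u <_) (sym (+-suc s k)) u<

range-split : ∀ {s k u} → InRange s (suc k) u → u ≡ s ⊎ InRange (suc s) k u
range-split {s} {k} {u} (s≤u , u<) with m≤n⇒m<n∨m≡n s≤u
... | inj₁ s<u = inj₂ (s<u , subst (u <_) (+-suc s k) u<)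
... | inj₂ s≡u = inj₁ (sym s≡u)

sumFrom-+ : ∀ f g s k → sumFrom (λ u → f u + g u) s k ≡ sumFrom f s k + sumFrom g s k
sumFrom-+ f g s zero = refl
sumFrom-+ f g s (suc k) =
  trans (cong ((f s + g s) +_) (sumFrom-+ f g (suc s) k)) (interchange (f s) (g s) (sumFrom f (suc s) k) (sumFrom g (suc s) k))

sumFrom-zero : ∀ s k → sumFrom (λ _ → 0) s k ≡ 0
sumFrom-zero s zero = refl
sumFrom-zero s (suc k) = sumFrom-zero (suc s) k

sumFrom-ones : ∀ s k → sumFrom (λ _ → 1) s k ≡ k
sumFrom-ones s zero = refl
sumFrom-ones s (suc k) = cong suc (sumFrom-ones (suc s) k)

sumFrom-cong : ∀ {f g} s k → (∀ u → InRange s k u → f u ≡ g u) → sumFrom f s k ≡ sumFrom g s k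
sumFrom-cong s zero _ = refl
sumFrom-cong s (suc k) f≡g = cong₂ _+_ (f≡g s range-head) (sumFrom-cong (suc s) k (λ u r → f≡g u (range-tail r)))

sumFrom-mono : ∀ {f g} s k → (∀ u → InRange s k u → f u ≤ g u) → sumFrom f s k ≤ sumFrom g s k
sumFrom-mono s zero _ = z≤n
sumFrom-mono s (suc k) f≤g = +-mono-≤ (f≤g s range-head) (sumFrom-mono (suc s) k (λ u r → f≤g u (range-tail r)))

sumFrom-tight : ∀ {f g} s k → (∀ u → InRange s k u → f u ≤ g u) →
  sumFrom g s k ≤ sumFrom f s k → ∀ u → InRange s k u → f u ≡ g u
sumFrom-tight s zero _ _ u r = ⊥-elim (range-empty r)
sumFrom-tight {f} {g} s (suc k) f≤g g≤f u r = tight-at (range-split r)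
  where
  F = sumFrom f (suc s) k
  G = sumFrom g (suc s) k
  tail-f≤g : ∀ u → InRange (suc s) k u → f u ≤ g u
  tail-f≤g u r = f≤g u (range-tail r)
  head≥ : g s ≤ f s
  head≥ = +-cancelʳ-≤ G (g s) (f s) (≤-trans g≤f (+-monoʳ-≤ (f s) (sumFrom-mono (suc s) k tail-f≤g)))
  tail≥ : G ≤ F
  tail≥ = +-cancelˡ-≤ (g s) G F (≤-trans g≤f (+-monoˡ-≤ F (f≤g s range-head)))
  tight-at : u ≡ s ⊎ InRange (suc s) k u → f u ≡ g u
  tight-at (inj₁ refl) = ≤-antisym (f≤g s range-head) head≥
  tight-at (inj₂ r′) = sumFrom-tight (suc s) k tail-f≤g tail≥ u r′

sumFrom-𝟙 : ∀ x s k → sumFrom (λ u → 𝟙 (u ≟ x)) s k ≡ 𝟙 (inRange? s k x)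
sumFrom-𝟙 x s zero = sym (𝟙-no (inRange? s 0 x) range-empty)
sumFrom-𝟙 x s (suc k) with s ≟ x
... | yes refl = trans (cong suc s∉tail) (sym (𝟙-yes (inRange? s (suc k) s) range-head))
  where
  s∉tail : sumFrom (λ u → 𝟙 (u ≟ s)) (suc s) k ≡ 0
  s∉tail = trans (sumFrom-𝟙 s (suc s) k) (𝟙-no (inRange? (suc s) k s) (λ r → <-irrefl refl (proj₁ r)))
... | no s≢x = trans (sumFrom-𝟙 x (suc s) k) (𝟙-cong range-tail from-tail (inRange? (suc s) k x) (inRange? s (suc k) x))
  where
  from-tail : InRange s (suc k) x → InRange (suc s) k x
  from-tail r with range-split r
  ... | inj₁ x≡s = contradiction (sym x≡s) s≢x
  ... | inj₂ r′ = r′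

Inside : ℕ → ℕ → ℕ → Set
Inside a b = InRange (suc a) (b ∸ suc a)

inside⇒between : ∀ {a b x} → a < b → Inside a b x → a < x × x < b
inside⇒between {a} a<b (a<x , x<) = a<x , subst (_ <_) (m+[n∸m]≡n a<b) x<

between⇒inside : ∀ {a b x} → a < b → a < x → x < b → Inside a b x
between⇒inside {a} a<b a<x x<b = a<x , subst (_ <_) (sym (m+[n∸m]≡n a<b)) x<b

-- Residue classes of sums.  Two labels below N sum to less than 2N, so "x + y ≡ K (mod N)"
-- with K < N amounts to x + y being K or K + N.

ClassSum : ℕ → ℕ → ℕ → Set
ClassSum N K s = s ≡ K ⊎ s ≡ K + N

class-unique : ∀ {N K K′ s} → K < N → K′ < N → ClassSum N K s → ClassSum N K′ s → K ≡ K′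
class-unique _ _ (inj₁ p) (inj₁ q) = trans (sym p) q
class-unique {N} {K} {K′} _ _ (inj₂ p) (inj₂ q) = +-cancelʳ-≡ N K K′ (trans (sym p) q)
class-unique {N} {K} {K′} K<N _ (inj₁ p) (inj₂ q) = contradiction (subst (N ≤_) (trans (sym q) p) (m≤n+m N K′)) (<⇒≱ K<N)
class-unique {N} {K} {K′} _ K′<N (inj₂ p) (inj₁ q) = contradiction (subst (N ≤_) (trans (sym p) q) (m≤n+m N K)) (<⇒≱ K′<N)

partner-unique : ∀ {N K x y z} → y < N → z < N → ClassSum N K (x + y) → ClassSum N K (x + z) → y ≡ z
partner-unique {x = x} {y} {z} _ _ (inj₁ p) (inj₁ q) = +-cancelˡ-≡ x y z (trans p (sym q))
partner-unique {x = x} {y} {z} _ _ (inj₂ p) (inj₂ q) = +-cancelˡ-≡ x y z (trans p (sym q))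
partner-unique {N} {K} {x} {y} {z} _ z<N (inj₁ p) (inj₂ q) = contradiction (subst (N ≤_) (sym z≡y+N) (m≤n+m N y)) (<⇒≱ z<N)
  where
  z≡y+N : z ≡ y + N
  z≡y+N = +-cancelˡ-≡ x z (y + N) (trans q (trans (cong (_+ N) (sym p)) (+-assoc x y N)))
partner-unique {N} {K} {x} {y} {z} y<N _ (inj₂ p) (inj₁ q) = contradiction (subst (N ≤_) (sym y≡z+N) (m≤n+m N z)) (<⇒≱ y<N)
  where
  y≡z+N : y ≡ z + N
  y≡z+N = +-cancelˡ-≡ x y (z + N) (trans p (trans (cong (_+ N) (sym q)) (+-assoc x z N)))

class-noninterleaving : ∀ {N K a b c d} → a < c → c < b → b < d → d < N →
  ClassSum N K (a + b) → ClassSum N K (c + d) → ⊥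
class-noninterleaving {N} {K} {a} {b} {c} {d} a<c c<b b<d d<N = compare
  where
  ab<cd : a + b < c + d
  ab<cd = +-mono-< a<c b<d
  cd<ab+N : c + d < a + b + N
  cd<ab+N = <-≤-trans (+-mono-< c<b d<N) (+-monoˡ-≤ N (m≤n+m b a))
  compare : ClassSum N K (a + b) → ClassSum N K (c + d) → ⊥
  compare (inj₁ p) (inj₁ q) = <-irrefl (trans p (sym q)) ab<cd
  compare (inj₂ p) (inj₂ q) = <-irrefl (trans p (sym q)) ab<cd
  compare (inj₂ p) (inj₁ q) = <⇒≱ ab<cd (subst₂ _≤_ (sym q) (sym p) (m≤m+n K N))
  compare (inj₁ p) (inj₂ q) = <-irrefl (trans q (cong (_+ N) (sym p))) cd<ab+N

odd-sum⇒distinct : ∀ {x y} → Odd (x + y) → y ≢ x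
odd-sum⇒distinct {x} o refl = even⇒¬odd (x , cong (x +_) (sym (+-identityʳ x))) o

partner-exists : ∀ {N K x} → Even N → Odd K → K < N → x < N →
  ∃[ y ] y < N × y ≢ x × ClassSum N K (x + y)
partner-exists {N} {K} {x} eN oK K<N x<N with x ≤? K
... | yes x≤K = K ∸ x , ≤-<-trans (m∸n≤m K x) K<N ,
                odd-sum⇒distinct (subst Odd (sym x+y≡K) oK) , inj₁ x+y≡K
  where
  x+y≡K : x + (K ∸ x) ≡ K
  x+y≡K = m+[n∸m]≡n x≤K
... | no x≰K = y , y<N , odd-sum⇒distinct (subst Odd (sym x+y≡K+N) K+N-odd) , inj₂ x+y≡K+N
  where
  y : ℕ
  y = (K + N) ∸ x
  x+y≡K+N : x + y ≡ K + N
  x+y≡K+N = m+[n∸m]≡n (≤-trans (<⇒≤ x<N) (m≤n+m N K))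
  y<N : y < N
  y<N = +-cancelˡ-< x y N (subst (_< x + N) (sym x+y≡K+N) (+-monoˡ-< N (≰⇒> x≰K)))
  K+N-odd : Odd (K + N)
  K+N-odd = subst Odd (+-comm N K) (even+odd eN oK)

hitting-set-size : ∀ {A : Set} {n} (E : List A) (S : Fin n → A → Set) →
  (∀ t → ∃[ e ] e ∈ E × S t e) → (∀ {t t′ e} → S t e → S t′ e → t ≡ t′) → n ≤ length E
hitting-set-size {n = n} E S hit disjoint = injective⇒≤ {f = position} position-injective
  where
  position : Fin n → Fin (length E)
  position t = Any.index (proj₁ (proj₂ (hit t)))
  position-in : ∀ t → S t (lookup E (position t))
  position-in t = subst (S t) (lookup-index (proj₁ (proj₂ (hit t)))) (proj₂ (proj₂ (hit t)))
  position-injective : ∀ {t t′} → position t ≡ position t′ → t ≡ t′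
  position-injective {t} {t′} eq = disjoint (position-in t) (subst (λ p → S t′ (lookup E p)) (sym eq) (position-in t′))

module _ {m : ℕ} where

  -- The m parallel classes of CGG(2m).  Class t consists of the edges whose label sum is
  -- 2t+1 modulo 2m; geometrically these are the m pairwise parallel chords of one direction.

  labelSum : Edge m → ℕ
  labelSum (i , j) = toℕ i + toℕ j

  residue : Fin m → ℕ
  residue t = suc (2 * toℕ t)

  InClass : Fin m → Edge m → Set
  InClass t e = ClassSum (2 * m) (residue t) (labelSum e)

  residue<2m : ∀ t → residue t < 2 * m
  residue<2m t = subst (_≤ 2 * m) (*-distribˡ-+ 2 1 (toℕ t)) (*-monoʳ-≤ 2 (toℕ<n t))

  class-index-unique : ∀ {t t′ e} → InClass t e → InClass t′ e → t ≡ t′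
  class-index-unique {t} {t′} c c′ =
    toℕ-injective (*-cancelˡ-≡ (toℕ t) (toℕ t′) 2 (suc-injective (class-unique (residue<2m t) (residue<2m t′) c c′)))

  edgeBetween : (v w : Vertex m) → toℕ w ≢ toℕ v →
    Σ[ e ∈ Edge m ] ValidEdge m e × Endpoint m v e × labelSum e ≡ toℕ v + toℕ w
  edgeBetween v w w≢v with <-cmp (toℕ v) (toℕ w)
  ... | tri< v<w _ _ = (v , w) , v<w , inj₁ refl , refl
  ... | tri≈ _ v≡w _ = contradiction (sym v≡w) w≢v
  ... | tri> _ _ w<v = (w , v) , w<v , inj₂ refl , +-comm (toℕ w) (toℕ v)

  classEdgeAt : (v : Vertex m) (t : Fin m) → Σ[ e ∈ Edge m ] ValidEdge m e × Endpoint m v e × InClass t e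
  classEdgeAt v t with partner-exists (m , refl) (toℕ t , refl) (residue<2m t) (toℕ<n v)
  ... | y , y<2m , y≢v , c with edgeBetween v (fromℕ< y<2m) (subst (_≢ toℕ v) (sym (toℕ-fromℕ< y<2m)) y≢v)
  ...   | e , valid , v∈e , sum≡ = e , valid , v∈e , subst (ClassSum (2 * m) (residue t)) sum-eq c
    where
    sum-eq : toℕ v + y ≡ labelSum e
    sum-eq = sym (trans sum≡ (cong (toℕ v +_) (toℕ-fromℕ< y<2m)))

  class-edge-unique : ∀ {t v e f} → ValidEdge m e → ValidEdge m f → Endpoint m v e → Endpoint m v f →
    InClass t e → InClass t f → e ≡ f
  class-edge-unique {e = a , b} {c , d} _ _ (inj₁ refl) (inj₁ refl) p q =
    cong (a ,_) (toℕ-injective (partner-unique (toℕ<n b) (toℕ<n d) p q))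
  class-edge-unique {t} {e = a , b} {c , d} a<b c<a (inj₁ refl) (inj₂ refl) p q =
    contradiction (<-trans (subst (_< toℕ a) (sym b≡c) c<a) a<b) (<-irrefl refl)
    where
    b≡c : toℕ b ≡ toℕ c
    b≡c = partner-unique (toℕ<n b) (toℕ<n c) p (subst (ClassSum (2 * m) (residue t)) (+-comm (toℕ c) (toℕ a)) q)
  class-edge-unique {t} {e = a , b} {c , d} b<a c<d (inj₂ refl) (inj₁ refl) p q =
    contradiction (<-trans (subst (_< toℕ b) a≡d b<a) c<d) (<-irrefl refl)
    where
    a≡d : toℕ a ≡ toℕ d
    a≡d = partner-unique (toℕ<n a) (toℕ<n d) (subst (ClassSum (2 * m) (residue t)) (+-comm (toℕ a) (toℕ b)) p) q
  class-edge-unique {t} {e = a , b} {c , d} _ _ (inj₂ refl) (inj₂ refl) p q =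
    cong (_, b) (toℕ-injective (partner-unique (toℕ<n a) (toℕ<n c)
      (subst (ClassSum (2 * m) (residue t)) (+-comm (toℕ a) (toℕ b)) p)
      (subst (ClassSum (2 * m) (residue t)) (+-comm (toℕ c) (toℕ b)) q)))

  class-disjoint : ∀ {t e f} → ValidEdge m e → ValidEdge m f → InClass t e → InClass t f → e ≢ f → Disjoint m e f
  class-disjoint {t} {e} {f} ve vf ce cf e≢f = no-shared , no-crossing e f ce cf
    where
    no-shared : ¬ ShareEndpoint m e f
    no-shared (v , v∈e , v∈f) = e≢f (class-edge-unique {t} ve vf v∈e v∈f ce cf)
    no-crossing : ∀ e f → InClass t e → InClass t f → ¬ Cross m e f
    no-crossing (a , b) (c , d) ce cf (inj₁ (a<c , c<b , b<d)) = class-noninterleaving a<c c<b b<d (toℕ<n d) ce cf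
    no-crossing (a , b) (c , d) ce cf (inj₂ (c<a , a<d , d<b)) = class-noninterleaving c<a a<d d<b (toℕ<n b) cf ce

  class-sum-odd : ∀ {t e} → InClass t e → Odd (labelSum e)
  class-sum-odd {t} (inj₁ p) = subst Odd (sym p) (toℕ t , refl)
  class-sum-odd {t} (inj₂ p) = subst Odd (sym p) (subst Odd (+-comm (2 * m) (residue t)) (even+odd (m , refl) (toℕ t , refl)))

  -- An edge [a,b] whose gap b - a is odd has odd order, the other arc 2m - (b - a) being odd too.
  odd-gap⇒odd-order : ∀ {a b : Vertex m} → toℕ a < toℕ b → Odd (toℕ b ∸ toℕ a) → Odd (order m (a , b))
  odd-gap⇒odd-order {a} {b} a<b o with ⊓-sel (toℕ b ∸ toℕ a) (2 * m ∸ (toℕ b ∸ toℕ a))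
  ... | inj₁ eq = subst Odd (sym eq) o
  ... | inj₂ eq = subst Odd (sym eq) (odd-complement (m , refl) o (≤-trans (m∸n≤m (toℕ b) (toℕ a)) (<⇒≤ (toℕ<n b))))

  class⇒odd-order : ∀ {t a b} → toℕ a < toℕ b → InClass t (a , b) → Odd (order m (a , b))
  class⇒odd-order {t} {a} {b} a<b c = odd-gap⇒odd-order a<b (odd-sum⇒odd-gap (<⇒≤ a<b) (class-sum-odd {t} {a , b} c))

  odd-gap⇒class : ∀ {a b : Vertex m} → toℕ a < toℕ b → Odd (toℕ b ∸ toℕ a) → ∃[ t ] InClass t (a , b)
  odd-gap⇒class {a} {b} a<b o with odd-gap⇒odd-sum (<⇒≤ a<b) o
  ... | j , sum≡ with j <? m
  ...   | yes j<m = fromℕ< j<m , inj₁ (trans sum≡ (cong (λ x → suc (2 * x)) (sym (toℕ-fromℕ< j<m))))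
  ...   | no j≮m = fromℕ< i<m , inj₂ (trans sum≡ (trans (cong suc 2j≡2i+2m) (cong (λ x → suc (2 * x) + 2 * m) (sym (toℕ-fromℕ< i<m)))))
    where
    i : ℕ
    i = j ∸ m
    i+m≡j : i + m ≡ j
    i+m≡j = m∸n+n≡m (≮⇒≥ j≮m)
    2j≡2i+2m : 2 * j ≡ 2 * i + 2 * m
    2j≡2i+2m = trans (cong (2 *_) (sym i+m≡j)) (*-distribˡ-+ 2 i m)
    double : ∀ n → 2 * n ≡ n + n
    double n = cong (n +_) (+-identityʳ n)
    j<2m : j < 2 * m
    j<2m = *-cancelˡ-< 2 j (2 * m) (subst (2 * j <_) (sym (double (2 * m)))
             (<-trans (n<1+n (2 * j)) (subst (_< 2 * m + 2 * m) sum≡ (+-mono-< (toℕ<n a) (toℕ<n b)))))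
    i<m : i < m
    i<m = +-cancelʳ-< m i m (subst₂ _<_ (sym i+m≡j) (double m) j<2m)

  hits : ℕ → Edge m → ℕ
  hits u (i , j) = 𝟙 (u ≟ toℕ i) + 𝟙 (u ≟ toℕ j)

  deg : List (Edge m) → ℕ → ℕ
  deg [] u = 0
  deg (e ∷ L) u = hits u e + deg L u

  rangeHits : ℕ → ℕ → Edge m → ℕ
  rangeHits s k (i , j) = 𝟙 (inRange? s k (toℕ i)) + 𝟙 (inRange? s k (toℕ j))

  sumFrom-deg : ∀ s k e L → sumFrom (deg (e ∷ L)) s k ≡ rangeHits s k e + sumFrom (deg L) s k
  sumFrom-deg s k (i , j) L = begin
    sumFrom (deg ((i , j) ∷ L)) s k                                  ≡⟨ sumFrom-+ (λ u → hits u (i , j)) (deg L) s k ⟩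
    sumFrom (λ u → hits u (i , j)) s k + sumFrom (deg L) s k          ≡⟨ cong (_+ sumFrom (deg L) s k) (sumFrom-+ _ _ s k) ⟩
    (sumFrom (λ u → 𝟙 (u ≟ toℕ i)) s k + sumFrom (λ u → 𝟙 (u ≟ toℕ j)) s k) + sumFrom (deg L) s k
      ≡⟨ cong (_+ sumFrom (deg L) s k) (cong₂ _+_ (sumFrom-𝟙 (toℕ i) s k) (sumFrom-𝟙 (toℕ j) s k)) ⟩
    rangeHits s k (i , j) + sumFrom (deg L) s k                       ∎
    where open ≡-Reasoning

  handshake : ∀ L → sumFrom (deg L) 0 (2 * m) ≡ 2 * length L
  handshake [] = sumFrom-zero 0 (2 * m)
  handshake ((i , j) ∷ L) = begin
    sumFrom (deg ((i , j) ∷ L)) 0 (2 * m)                   ≡⟨ sumFrom-deg 0 (2 * m) (i , j) L ⟩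
    rangeHits 0 (2 * m) (i , j) + sumFrom (deg L) 0 (2 * m) ≡⟨ cong₂ _+_ both-in (handshake L) ⟩
    2 + 2 * length L                                        ≡⟨ *-distribˡ-+ 2 1 (length L) ⟨
    2 * length ((i , j) ∷ L)                                ∎
    where
    open ≡-Reasoning
    both-in : rangeHits 0 (2 * m) (i , j) ≡ 2
    both-in = cong₂ _+_ (𝟙-yes (inRange? 0 (2 * m) (toℕ i)) (z≤n , toℕ<n i))
                        (𝟙-yes (inRange? 0 (2 * m) (toℕ j)) (z≤n , toℕ<n j))

  sumFrom-deg-even : ∀ s k L → (∀ e → e ∈ L → Even (rangeHits s k e)) → Even (sumFrom (deg L) s k)
  sumFrom-deg-even s k [] _ = 0 , sumFrom-zero s k
  sumFrom-deg-even s k (e ∷ L) evens = subst Even (sym (sumFrom-deg s k e L))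
    (even+even (evens e (here refl)) (sumFrom-deg-even s k L (λ f f∈L → evens f (there f∈L))))

  endpoint⇒hits : ∀ v e → Endpoint m v e → 1 ≤ hits (toℕ v) e
  endpoint⇒hits v (i , j) (inj₁ refl) = ≤-trans (≤-reflexive (sym (𝟙-yes (toℕ v ≟ toℕ v) refl))) (m≤m+n _ _)
  endpoint⇒hits v (i , j) (inj₂ refl) = ≤-trans (≤-reflexive (sym (𝟙-yes (toℕ v ≟ toℕ v) refl))) (m≤n+m _ _)

  hits⇒endpoint : ∀ v e → 1 ≤ hits (toℕ v) e → Endpoint m v e
  hits⇒endpoint v (i , j) h with toℕ v ≟ toℕ i | toℕ v ≟ toℕ j
  ... | yes v≡i | _ = inj₁ (toℕ-injective v≡i)
  ... | no _ | yes v≡j = inj₂ (toℕ-injective v≡j)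
  ... | no _ | no _ = contradiction h λ ()

  hits≤1 : ∀ u e → ValidEdge m e → hits u e ≤ 1
  hits≤1 u (i , j) i<j with u ≟ toℕ i | u ≟ toℕ j
  ... | yes refl | yes u≡j = contradiction u≡j (<⇒≢ i<j)
  ... | yes _ | no _ = ≤-refl
  ... | no _ | yes _ = ≤-refl
  ... | no _ | no _ = z≤n

  hits≤deg : ∀ u {e L} → e ∈ L → hits u e ≤ deg L u
  hits≤deg u {L = f ∷ L} (here refl) = m≤m+n (hits u f) (deg L u)
  hits≤deg u {L = f ∷ L} (there e∈L) = ≤-trans (hits≤deg u e∈L) (m≤n+m (deg L u) (hits u f))

  covered⇒deg≥1 : ∀ v {e L} → e ∈ L → Endpoint m v e → 1 ≤ deg L (toℕ v)
  covered⇒deg≥1 v {e} e∈L v∈e = ≤-trans (endpoint⇒hits v e v∈e) (hits≤deg (toℕ v) e∈L)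

  deg≥1⇒covered : ∀ v L → 1 ≤ deg L (toℕ v) → ∃[ e ] e ∈ L × Endpoint m v e
  deg≥1⇒covered v (e ∷ L) h with hits (toℕ v) e in eq
  ... | suc _ = e , here refl , hits⇒endpoint v e (subst (1 ≤_) (sym eq) (s≤s z≤n))
  ... | zero with deg≥1⇒covered v L h
  ...   | f , f∈L , v∈f = f , there f∈L , v∈f

  two-edges⇒deg≥2 : ∀ v {e f} L → e ∈ L → f ∈ L → e ≢ f → Endpoint m v e → Endpoint m v f → 2 ≤ deg L (toℕ v)
  two-edges⇒deg≥2 v (g ∷ L) (here refl) (here refl) e≢f _ _ = contradiction refl e≢f
  two-edges⇒deg≥2 v (g ∷ L) (here refl) (there f∈L) _ v∈g v∈f =
    +-mono-≤ (endpoint⇒hits v g v∈g) (covered⇒deg≥1 v f∈L v∈f)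
  two-edges⇒deg≥2 v (g ∷ L) (there e∈L) (here refl) _ v∈e v∈g =
    subst (2 ≤_) (+-comm (deg L (toℕ v)) (hits (toℕ v) g)) (+-mono-≤ (covered⇒deg≥1 v e∈L v∈e) (endpoint⇒hits v g v∈g))
  two-edges⇒deg≥2 v (g ∷ L) (there e∈L) (there f∈L) e≢f v∈e v∈f =
    ≤-trans (two-edges⇒deg≥2 v L e∈L f∈L e≢f v∈e v∈f) (m≤n+m (deg L (toℕ v)) (hits (toℕ v) g))

  NoSharedEndpoint : List (Edge m) → Set
  NoSharedEndpoint L = ∀ e f → e ∈ L → f ∈ L → e ≢ f → ¬ ShareEndpoint m e f

  Covers : List (Edge m) → Set
  Covers L = ∀ (v : Vertex m) → ∃[ e ] e ∈ L × Endpoint m v e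

  deg≤1 : ∀ L → IsEdgeSet m L → NoSharedEndpoint L → ∀ (v : Vertex m) → deg L (toℕ v) ≤ 1
  deg≤1 [] _ _ v = z≤n
  deg≤1 (e ∷ L) (valid-e ∷ valid , e∉L ∷ unique) noShare v with n≤1⇒n≡0∨n≡1 (hits≤1 (toℕ v) e valid-e)
  ... | inj₁ v∉e = +-mono-≤ (≤-reflexive v∉e) (deg≤1 L (valid , unique) noShare-tail v)
    where
    noShare-tail : NoSharedEndpoint L
    noShare-tail f g f∈L g∈L = noShare f g (there f∈L) (there g∈L)
  ... | inj₂ v∈e = +-mono-≤ (≤-reflexive v∈e) (≮⇒≥ v∉L)
    where
    v∉L : ¬ 1 ≤ deg L (toℕ v)
    v∉L pos with deg≥1⇒covered v L pos
    ... | f , f∈L , v∈f = noShare e f (here refl) (there f∈L) (All.lookup e∉L f∈L)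
                            (v , hits⇒endpoint v e (≤-reflexive (sym v∈e)) , v∈f)

  Perfect : List (Edge m) → Set
  Perfect L = ∀ (v : Vertex m) → deg L (toℕ v) ≡ 1

  at-labels : ∀ {P : ℕ → Set} → (∀ (v : Vertex m) → P (toℕ v)) → ∀ u → InRange 0 (2 * m) u → P u
  at-labels {P} h u (_ , u<2m) = subst P (toℕ-fromℕ< u<2m) (h (fromℕ< u<2m))

  perfect-length : ∀ L → Perfect L → length L ≡ m
  perfect-length L perfect = *-cancelˡ-≡ (length L) m 2 (begin
    2 * length L                ≡⟨ handshake L ⟨
    sumFrom (deg L) 0 (2 * m)   ≡⟨ sumFrom-cong 0 (2 * m) (at-labels perfect) ⟩
    sumFrom (λ _ → 1) 0 (2 * m) ≡⟨ sumFrom-ones 0 (2 * m) ⟩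
    2 * m                       ∎)
    where open ≡-Reasoning

  matching-perfect : ∀ L → IsEdgeSet m L → NoSharedEndpoint L → length L ≡ m → Perfect L
  matching-perfect L edges noShare len v =
    sumFrom-tight 0 (2 * m) (at-labels (deg≤1 L edges noShare)) (≤-reflexive degree-sum) (toℕ v) (z≤n , toℕ<n v)
    where
    degree-sum : sumFrom (λ _ → 1) 0 (2 * m) ≡ sumFrom (deg L) 0 (2 * m)
    degree-sum = trans (sumFrom-ones 0 (2 * m)) (sym (trans (handshake L) (cong (2 *_) len)))

  small-cover-perfect : ∀ L → length L ≤ m → Covers L → Perfect L
  small-cover-perfect L len≤m covers v =
    sym (sumFrom-tight 0 (2 * m) (at-labels deg≥1) degree-sum (toℕ v) (z≤n , toℕ<n v))
    where
    deg≥1 : ∀ (v : Vertex m) → 1 ≤ deg L (toℕ v)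
    deg≥1 v with covers v
    ... | e , e∈L , v∈e = covered⇒deg≥1 v e∈L v∈e
    degree-sum : sumFrom (deg L) 0 (2 * m) ≤ sumFrom (λ _ → 1) 0 (2 * m)
    degree-sum = subst₂ _≤_ (sym (handshake L)) (sym (sumFrom-ones 0 (2 * m))) (*-monoʳ-≤ 2 len≤m)

  perfect-covers : ∀ {L} → Perfect L → Covers L
  perfect-covers {L} perfect v = deg≥1⇒covered v L (≤-reflexive (sym (perfect v)))

  perfect-unique : ∀ {L} → Perfect L → ∀ (v : Vertex m) e f → e ∈ L → f ∈ L → Endpoint m v e → Endpoint m v f → e ≡ f
  perfect-unique {L} perfect v e f e∈L f∈L v∈e v∈f with ≡-dec Fin._≟_ Fin._≟_ e f
  ... | yes e≡f = e≡f
  ... | no e≢f = contradiction (subst (2 ≤_) (perfect v) (two-edges⇒deg≥2 v L e∈L f∈L e≢f v∈e v∈f)) (<-irrefl refl)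

  perfect⇒perfect-matching : ∀ {L} → IsEdgeSet m L → Perfect L → IsPerfectMatching m L
  perfect⇒perfect-matching {L} edges perfect =
    edges , perfect-length L perfect , λ v → perfect-covers perfect v , perfect-unique perfect v

  spm-no-shared : ∀ {M} → IsSPM m M → NoSharedEndpoint M
  spm-no-shared (_ , _ , disjoint) e f e∈M f∈M e≢f = proj₁ (disjoint e f e∈M f∈M e≢f)

  spm-perfect : ∀ {M} → IsSPM m M → Perfect M
  spm-perfect {M} spm@(edges , len , _) = matching-perfect M edges (spm-no-shared spm) len

  nested-or-separate : ∀ {a b c d : Vertex m} → toℕ a < toℕ b → toℕ c < toℕ d → Disjoint m (a , b) (c , d) →
    (Inside (toℕ a) (toℕ b) (toℕ c) → Inside (toℕ a) (toℕ b) (toℕ d)) ×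
    (Inside (toℕ a) (toℕ b) (toℕ d) → Inside (toℕ a) (toℕ b) (toℕ c))
  nested-or-separate {a} {b} {c} {d} a<b c<d (no-shared , no-crossing) = c-in⇒d-in , d-in⇒c-in
    where
    In : Vertex m → Set
    In x = Inside (toℕ a) (toℕ b) (toℕ x)
    c-in⇒d-in : In c → In d
    c-in⇒d-in c-in with inside⇒between a<b c-in
    ... | a<c , c<b with <-cmp (toℕ d) (toℕ b)
    ...   | tri< d<b _ _ = between⇒inside a<b (<-trans a<c c<d) d<b
    ...   | tri≈ _ d≡b _ = ⊥-elim (no-shared (b , inj₂ refl , inj₂ (toℕ-injective (sym d≡b))))
    ...   | tri> _ _ b<d = ⊥-elim (no-crossing (inj₁ (a<c , c<b , b<d)))
    d-in⇒c-in : In d → In c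
    d-in⇒c-in d-in with inside⇒between a<b d-in
    ... | a<d , d<b with <-cmp (toℕ a) (toℕ c)
    ...   | tri< a<c _ _ = between⇒inside a<b a<c (<-trans c<d d<b)
    ...   | tri≈ _ a≡c _ = ⊥-elim (no-shared (a , inj₁ refl , inj₁ (toℕ-injective a≡c)))
    ...   | tri> _ _ c<a = ⊥-elim (no-crossing (inj₂ (c<a , a<d , d<b)))

  -- Every edge [a,b] of a simple perfect matching has odd gap: the vertices strictly between
  -- a and b are matched among themselves, so there is an even number b - a - 1 of them.
  spm-odd-gap : ∀ {M a b} → IsSPM m M → (a , b) ∈ M → Odd (toℕ b ∸ toℕ a)
  spm-odd-gap {M} {a} {b} spm@((valid , _) , _ , disjoint) ab∈M =
    subst Odd (sym (+-∸-assoc 1 a<b)) (suc-even (subst Even inner-sum (sumFrom-deg-even s k M even-hits)))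
    where
    a<b : toℕ a < toℕ b
    a<b = All.lookup valid ab∈M
    s k : ℕ
    s = suc (toℕ a)
    k = toℕ b ∸ s
    inner-sum : sumFrom (deg M) s k ≡ k
    inner-sum = trans (sumFrom-cong s k (λ u r → at-labels (spm-perfect spm) u (z≤n , inside⇒vertex r)))
                      (sumFrom-ones s k)
      where
      inside⇒vertex : ∀ {u} → Inside (toℕ a) (toℕ b) u → u < 2 * m
      inside⇒vertex r = <-trans (proj₂ (inside⇒between a<b r)) (toℕ<n b)
    even-hits : ∀ e → e ∈ M → Even (rangeHits s k e)
    even-hits (c , d) cd∈M with ≡-dec Fin._≟_ Fin._≟_ (a , b) (c , d)
    ... | yes refl = 𝟙+𝟙-even a-out b-out (inRange? s k (toℕ a)) (inRange? s k (toℕ b))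
      where
      a-out : Inside (toℕ a) (toℕ b) (toℕ a) → Inside (toℕ a) (toℕ b) (toℕ b)
      a-out r = ⊥-elim (<-irrefl refl (proj₁ r))
      b-out : Inside (toℕ a) (toℕ b) (toℕ b) → Inside (toℕ a) (toℕ b) (toℕ a)
      b-out r = ⊥-elim (<-irrefl refl (proj₂ (inside⇒between a<b r)))
    ... | no ab≢cd with nested-or-separate a<b (All.lookup valid cd∈M) (disjoint (a , b) (c , d) ab∈M cd∈M ab≢cd)
    ...   | c⇒d , d⇒c = 𝟙+𝟙-even c⇒d d⇒c (inRange? s k (toℕ c)) (inRange? s k (toℕ d))

  valid? : (e : Edge m) → Dec (ValidEdge m e)
  valid? (i , j) = toℕ i <? toℕ j

  inClass? : (t : Fin m) (e : Edge m) → Dec (InClass t e)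
  inClass? t e = (labelSum e ≟ residue t) ⊎-dec (labelSum e ≟ residue t + 2 * m)

  allEdges : List (Edge m)
  allEdges = filter valid? (cartesianProduct (allFin (2 * m)) (allFin (2 * m)))

  classEdges : Fin m → List (Edge m)
  classEdges t = filter (inClass? t) allEdges

  ∈classEdges⁻ : ∀ {t e} → e ∈ classEdges t → ValidEdge m e × InClass t e
  ∈classEdges⁻ {t} e∈ with ∈-filter⁻ (inClass? t) {xs = allEdges} e∈
  ... | e∈all , c = proj₂ (∈-filter⁻ valid? {xs = cartesianProduct (allFin (2 * m)) (allFin (2 * m))} e∈all) , c

  ∈classEdges⁺ : ∀ {t e} → ValidEdge m e → InClass t e → e ∈ classEdges t
  ∈classEdges⁺ {t} {i , j} valid c =
    ∈-filter⁺ (inClass? t) (∈-filter⁺ valid? (∈-cartesianProduct⁺ (∈-allFin i) (∈-allFin j)) valid) c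

  classEdges-spm : ∀ t → IsSPM m (classEdges t)
  classEdges-spm t = edges , perfect-length (classEdges t) perfect , disjoint
    where
    edges : IsEdgeSet m (classEdges t)
    edges = All.tabulate (λ e∈ → proj₁ (∈classEdges⁻ {t} e∈)) ,
            Unique.filter⁺ (inClass? t) (Unique.filter⁺ valid? (Unique.cartesianProduct⁺ (Unique.allFin⁺ _) (Unique.allFin⁺ _)))
    disjoint : ∀ e f → e ∈ classEdges t → f ∈ classEdges t → e ≢ f → Disjoint m e f
    disjoint e f e∈ f∈ with ∈classEdges⁻ {t} e∈ | ∈classEdges⁻ {t} f∈
    ... | ve , ce | vf , cf = class-disjoint {t} ve vf ce cf
    noShare : NoSharedEndpoint (classEdges t)
    noShare e f e∈ f∈ e≢f = proj₁ (disjoint e f e∈ f∈ e≢f)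
    covers : Covers (classEdges t)
    covers v = let (e , valid , v∈e , c) = classEdgeAt v t in e , ∈classEdges⁺ {t} valid c , v∈e
    perfect : Perfect (classEdges t)
    perfect v = ≤-antisym (deg≤1 (classEdges t) edges noShare v)
                          (let (e , e∈ , v∈e) = covers v in covered⇒deg≥1 v e∈ v∈e)

  -- An edge set meeting every SPM has at least m edges, as it must meet each of the m classes.
  meets-spm⇒≥m : ∀ E → MeetsAllSPM m E → m ≤ length E
  meets-spm⇒≥m E meets = hitting-set-size E InClass meets-class (λ {t} {t′} {e} → class-index-unique {t} {t′} {e})
    where
    meets-class : ∀ t → ∃[ e ] e ∈ E × InClass t e
    meets-class t = let (e , e∈E , e∈class) = meets (classEdges t) (classEdges-spm t)
                    in e , e∈E , proj₂ (∈classEdges⁻ {t} e∈class)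

  -- The star of v: the edge at v of each class, i.e. all m edges of odd order at v.
  -- The construction of classEdge is kept abstract: only its specification is used.
  abstract
    classEdge : Vertex m → Fin m → Edge m
    classEdge v t = proj₁ (classEdgeAt v t)

    classEdge-spec : ∀ v t → ValidEdge m (classEdge v t) × Endpoint m v (classEdge v t) × InClass t (classEdge v t)
    classEdge-spec v t = proj₂ (classEdgeAt v t)

  star : Vertex m → List (Edge m)
  star v = tabulate (classEdge v)

  star⁻ : ∀ {v e} → e ∈ star v → ValidEdge m e × Endpoint m v e × Odd (order m e)
  star⁻ {v} e∈ with ∈-tabulate⁻ e∈
  ... | t , refl = let (valid , v∈e , c) = classEdge-spec v t
                   in valid , v∈e , class⇒odd-order {t} {proj₁ (classEdge v t)} {proj₂ (classEdge v t)} valid c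

  star⁺ : ∀ {v t e} → ValidEdge m e → Endpoint m v e → InClass t e → e ∈ star v
  star⁺ {v} {t} {e} valid v∈e c = subst (_∈ star v) same (∈-tabulate⁺ t)
    where
    same : classEdge v t ≡ e
    same = let (valid′ , v∈e′ , c′) = classEdge-spec v t in class-edge-unique {t} {v} {classEdge v t} {e} valid′ valid v∈e′ v∈e c′ c

  -- Each star is a blocker: every SPM covers v by an edge of odd gap, which lies in some class.
  star-blocker : ∀ v → IsBlocker m (star v)
  star-blocker v = edges , meets , minimal
    where
    class-of : ∀ t → InClass t (classEdge v t)
    class-of t = proj₂ (proj₂ (classEdge-spec v t))
    edges : IsEdgeSet m (star v)
    edges = All.tabulate (λ e∈ → proj₁ (star⁻ e∈)) ,
            Unique.tabulate⁺ (λ {t} {t′} eq → class-index-unique {t} {t′} {classEdge v t} (class-of t) (subst (InClass t′) (sym eq) (class-of t′)))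
    meets : MeetsAllSPM m (star v)
    meets M spm = let (e , e∈M , v∈e) = perfect-covers (spm-perfect spm) v in meet-at e e∈M v∈e
      where
      meet-at : ∀ e → e ∈ M → Endpoint m v e → Meet m (star v) M
      meet-at (a , b) ab∈M v∈ab =
        let a<b = All.lookup (proj₁ (proj₁ spm)) ab∈M
            (t , c) = odd-gap⇒class a<b (spm-odd-gap spm ab∈M)
        in (a , b) , star⁺ {v} {t} {a , b} a<b v∈ab c , ab∈M
    minimal : ∀ E → IsEdgeSet m E → MeetsAllSPM m E → length (star v) ≤ length E
    minimal E _ E-meets = subst (_≤ length E) (sym (length-tabulate (classEdge v))) (meets-spm⇒≥m E E-meets)

spm-exists : ∀ m → ∃[ M ] IsSPM m M
spm-exists zero = [] , ([] , []) , refl , λ _ _ ()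
spm-exists (suc m) = classEdges Fin.zero , classEdges-spm Fin.zero

module _ {m : ℕ} {C : List (Edge m)} where

  -- A co-blocker has at most m edges: any SPM meets every blocker, so it competes with C.
  coblocker-size : IsCoBlocker m C → length C ≤ m
  coblocker-size (_ , _ , minimal) =
    let (M , spm@(edges , len , _)) = spm-exists m
    in subst (length C ≤_) len (minimal M edges (λ B (_ , B-meets , _) → let (e , e∈B , e∈M) = B-meets M spm in e , e∈M , e∈B))

  -- A co-blocker meets every star, hence covers each vertex by an edge of odd order.
  coblocker-odd-cover : IsCoBlocker m C → ∀ v → ∃[ e ] e ∈ C × Endpoint m v e × Odd (order m e)
  coblocker-odd-cover (_ , meets-blockers , _) v =
    let (e , e∈C , e∈star) = meets-blockers (star {m} v) (star-blocker {m} v)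
        (_ , v∈e , odd) = star⁻ {m} {v} e∈star
    in e , e∈C , v∈e , odd

lemma1 : (m : ℕ) (C : List (Edge m)) → IsCoBlocker m C →
    IsPerfectMatching m C × All (λ e → Odd (order m e)) C
lemma1 m C coblocker@(edges , _ , _) = perfect⇒perfect-matching {m} edges perfect , All.tabulate odd-order
  where
  perfect : Perfect {m} C
  perfect = small-cover-perfect {m} C (coblocker-size coblocker)
              (λ v → let (e , e∈C , v∈e , _) = coblocker-odd-cover coblocker v in e , e∈C , v∈e)
  odd-order : ∀ {e} → e ∈ C → Odd (order m e)
  odd-order {i , j} ij∈C =
    let (e , e∈C , i∈e , odd) = coblocker-odd-cover coblocker i
    in subst (λ f → Odd (order m f)) (perfect-unique {m} perfect i e (i , j) e∈C ij∈C i∈e (inj₁ refl)) odd
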